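{- Let $\phi$ be a formula, and let $\mathcal{N}$ be the set of formulas associated to $\phi$ as described in the context. Then $\phi$ is provable in intuitionistic propositional logic if and only if $\mathcal{N}\vdash\flat\phi$.
   Context: Let $\mathbb{B}$ be the set of basic sentences (propositional atoms other than $\bot$); formulas are built from $\mathbb{B}$ and $\bot$ with $\to,\land,\lor$. For a set of formulas $S$ and formula $\psi$, $S\vdash\psi$ means $\psi$ is derivable in intuitionistic propositional logic from hypotheses in $S$. Fix a formula $\phi$ and let $\Xi$ be the set of subformulas of $\phi$. Fix an injection $\flat:\Xi\cup\{\bot\}\to\mathbb{B}$ with $\flat p=p$ for every $p\in\Xi\cap\mathbb{B}$. For $\chi\in\Xi$ define a set of formulas $\mathcal{M}_{\mathbb{B}}(\chi)$: it is empty if $\chi$ is atomic; and - $\mathcal{M}_{\mathbb{B}}(\chi_1\land\chi_2)=\{\flat(\chi_1\land\chi_2)\to\flat\chi_1,\ \flat(\chi_1\land\chi_2)\to\flat\chi_2,\ \flat\chi_1\land\flat\chi_2\to\flat(\chi_1\land\chi_2)\}$; - $\mathcal{M}_{\mathbb{B}}(\chi_1\lor\chi_2)=\{\flat\chi_1\to\flat(\chi_1\lor\chi_2),\ \flat\chi_2\to\flat(\chi_1\lor\chi_2)\}\cup\{\flat(\chi_1\lor\chi_2)\land(\flat\chi_1\to x)\land(\flat\chi_2\to x)\to x\mid x\in\mathbb{B}\}$; - $\mathcal{M}_{\mathbb{B}}(\chi_1\to\chi_2)=\{\flat(\chi_1\to\chi_2)\land\flat\chi_1\to\flat\chi_2,\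 (\flat\chi_1\to\flat\chi_2)\to\flat(\chi_1\to\chi_2)\}$. Then $\mathcal{N}:=\bigcup_{\chi\in\Xi}\mathcal{M}_{\mathbb{B}}(\chi)\cup\{\flat\bot\to x\mid x\in\mathbb{B}\}$. -}

module Defs where

open import Data.Nat using (ℕ)
open import Data.List using (List; []; _∷_)
open import Data.List.Membership.Propositional using (_∈_)
open import Data.Product using (Σ; _×_; ∃)
open import Data.Sum using (_⊎_)
open import Data.Empty using (⊥)
open import Relation.Binary.PropositionalEquality using (_≡_)

-- Basic sentences 𝔹 are represented by ℕ (a countably infinite set of atoms).
infixr 6 _∧_
infixr 5 _∨_
infixr 4 _⇒_

data Form : Set where
  atom : ℕ → Form
  ⊥'   : Form
  _⇒_  : Form → Form → Form
  _∧_  : Form → Form → Form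
  _∨_  : Form → Form → Form

data Sub : Form → Form → Set where
  here : ∀ {φ} → Sub φ φ
  ⇒l   : ∀ {χ a b} → Sub χ a → Sub χ (a ⇒ b)
  ⇒r   : ∀ {χ a b} → Sub χ b → Sub χ (a ⇒ b)
  ∧l   : ∀ {χ a b} → Sub χ a → Sub χ (a ∧ b)
  ∧r   : ∀ {χ a b} → Sub χ b → Sub χ (a ∧ b)
  ∨l   : ∀ {χ a b} → Sub χ a → Sub χ (a ∨ b)
  ∨r   : ∀ {χ a b} → Sub χ b → Sub χ (a ∨ b)

FormSet : Set₁
FormSet = Form → Set

data Der (S : FormSet) : List Form → Form → Set where
  hypS : ∀ {Γ A} → S A → Der S Γ A
  hypΓ : ∀ {Γ A} → A ∈ Γ → Der S Γ A
  ⇒I   : ∀ {Γ A B} → Der S (A ∷ Γ) B → Der S Γ (A ⇒ B)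
  ⇒E   : ∀ {Γ A B} → Der S Γ (A ⇒ B) → Der S Γ A → Der S Γ B
  ∧I   : ∀ {Γ A B} → Der S Γ A → Der S Γ B → Der S Γ (A ∧ B)
  ∧E₁  : ∀ {Γ A B} → Der S Γ (A ∧ B) → Der S Γ A
  ∧E₂  : ∀ {Γ A B} → Der S Γ (A ∧ B) → Der S Γ B
  ∨I₁  : ∀ {Γ A B} → Der S Γ A → Der S Γ (A ∨ B)
  ∨I₂  : ∀ {Γ A B} → Der S Γ B → Der S Γ (A ∨ B)
  ∨E   : ∀ {Γ A B C} → Der S Γ (A ∨ B) → Der S (A ∷ Γ) C → Der S (B ∷ Γ) C → Der S Γ C
  ⊥E   : ∀ {Γ A} → Der S Γ ⊥' → Der S Γ A

_⊢_ : FormSet → Form → Set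
S ⊢ ψ = Der S [] ψ

Provable : Form → Set
Provable ψ = (λ _ → ⊥) ⊢ ψ

InΞ⊥ : Form → Form → Set
InΞ⊥ φ χ = Sub χ φ ⊎ χ ≡ ⊥'

-- ♭ : Ξ ∪ {⊥} → 𝔹 is represented by a total function Form → ℕ whose values
-- outside Ξ ∪ {⊥} are irrelevant; the conditions are imposed only on Ξ ∪ {⊥}.
IsFlat : Form → (Form → ℕ) → Set
IsFlat φ ♭ =
  (∀ χ ψ → InΞ⊥ φ χ → InΞ⊥ φ ψ → ♭ χ ≡ ♭ ψ → χ ≡ ψ)
  × (∀ p → Sub (atom p) φ → ♭ (atom p) ≡ p)

fl : (Form → ℕ) → Form → Form
fl ♭ χ = atom (♭ χ)

data M (♭ : Form → ℕ) : Form → Form → Set where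
  ∧-1 : ∀ {a b} → M ♭ (a ∧ b) (fl ♭ (a ∧ b) ⇒ fl ♭ a)
  ∧-2 : ∀ {a b} → M ♭ (a ∧ b) (fl ♭ (a ∧ b) ⇒ fl ♭ b)
  ∧-3 : ∀ {a b} → M ♭ (a ∧ b) ((fl ♭ a ∧ fl ♭ b) ⇒ fl ♭ (a ∧ b))
  ∨-1 : ∀ {a b} → M ♭ (a ∨ b) (fl ♭ a ⇒ fl ♭ (a ∨ b))
  ∨-2 : ∀ {a b} → M ♭ (a ∨ b) (fl ♭ b ⇒ fl ♭ (a ∨ b))
  ∨-3 : ∀ {a b} (x : ℕ) →
        M ♭ (a ∨ b) (((fl ♭ (a ∨ b) ∧ (fl ♭ a ⇒ atom x)) ∧ (fl ♭ b ⇒ atom x)) ⇒ atom x)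
  ⇒-1 : ∀ {a b} → M ♭ (a ⇒ b) ((fl ♭ (a ⇒ b) ∧ fl ♭ a) ⇒ fl ♭ b)
  ⇒-2 : ∀ {a b} → M ♭ (a ⇒ b) ((fl ♭ a ⇒ fl ♭ b) ⇒ fl ♭ (a ⇒ b))

N : Form → (Form → ℕ) → FormSet
N φ ♭ ψ = (Σ Form λ χ → Sub χ φ × M ♭ χ ψ) ⊎ (∃ λ (x : ℕ) → ψ ≡ (fl ♭ ⊥' ⇒ atom x))

-- (⇒) Read contexts of N as worlds of a Kripke model in which an atom
-- holds when it is derivable from N, ⊥ holds when every atom is, and a
-- disjunction holds when it eliminates into every atom.  By induction on a
-- subformula χ of φ, a world forces χ exactly when it derives ♭χ: the
-- axioms of N are precisely the introduction and elimination steps this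
-- needs.  A proof of φ is forced everywhere, hence N ⊢ ♭φ.
--
-- (⇐) ♭ is injective on the subformulas of φ together with ⊥, so
-- substituting χ back for each atom ♭χ turns every axiom of N into an
-- intuitionistic tautology and ♭φ into φ.

module Submission where

open import Defs
open import Data.Nat using (ℕ; _≟_)
open import Data.List using (List; []; _∷_; _++_; map)
open import Data.List.Membership.Propositional using (_∈_; find; lose)
open import Data.List.Membership.Propositional.Properties
  using (∈-map⁺; ∈-++⁺ˡ; ∈-++⁺ʳ; ∈-++⁻)
open import Data.List.Relation.Binary.Subset.Propositional using (_⊆_)
open import Data.List.Relation.Binary.Subset.Propositional.Properties
  using (⊆-refl; ⊆-trans; xs⊆x∷xs; ∷⁺ʳ)
open import Data.List.Relation.Unary.Any using (here; there; any?)
open import Data.Product using (_×_; _,_; proj₁; proj₂)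
open import Data.Sum using (inj₁; inj₂; [_,_])
open import Data.Empty using (⊥)
open import Function using (_∘_)
open import Function.Bundles using (_⇔_; mk⇔)
open import Relation.Nullary using (yes; no; contradiction)
open import Relation.Binary.PropositionalEquality using (_≡_; refl; sym; cong; subst)

Der-weaken : ∀ {S Γ Δ A} → Γ ⊆ Δ → Der S Γ A → Der S Δ A
Der-weaken s (hypS h)   = hypS h
Der-weaken s (hypΓ x)   = hypΓ (s x)
Der-weaken s (⇒I d)     = ⇒I (Der-weaken (∷⁺ʳ _ s) d)
Der-weaken s (⇒E d e)   = ⇒E (Der-weaken s d) (Der-weaken s e)
Der-weaken s (∧I d e)   = ∧I (Der-weaken s d) (Der-weaken s e)
Der-weaken s (∧E₁ d)    = ∧E₁ (Der-weaken s d)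
Der-weaken s (∧E₂ d)    = ∧E₂ (Der-weaken s d)
Der-weaken s (∨I₁ d)    = ∨I₁ (Der-weaken s d)
Der-weaken s (∨I₂ d)    = ∨I₂ (Der-weaken s d)
Der-weaken s (∨E d e f) =
  ∨E (Der-weaken s d) (Der-weaken (∷⁺ʳ _ s) e) (Der-weaken (∷⁺ʳ _ s) f)
Der-weaken s (⊥E d)     = ⊥E (Der-weaken s d)

Sub-trans : ∀ {χ ψ φ} → Sub χ ψ → Sub ψ φ → Sub χ φ
Sub-trans s here   = s
Sub-trans s (⇒l t) = ⇒l (Sub-trans s t)
Sub-trans s (⇒r t) = ⇒r (Sub-trans s t)
Sub-trans s (∧l t) = ∧l (Sub-trans s t)
Sub-trans s (∧r t) = ∧r (Sub-trans s t)
Sub-trans s (∨l t) = ∨l (Sub-trans s t)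
Sub-trans s (∨r t) = ∨r (Sub-trans s t)

module Forcing (S : FormSet) where

  infix 3 _⊩_ _⊩*_

  _⊩_ : List Form → Form → Set
  Γ ⊩ atom p = Der S Γ (atom p)
  Γ ⊩ ⊥'     = ∀ x → Der S Γ (atom x)
  Γ ⊩ A ⇒ B  = ∀ {Δ} → Γ ⊆ Δ → Δ ⊩ A → Δ ⊩ B
  Γ ⊩ A ∧ B  = Γ ⊩ A × Γ ⊩ B
  Γ ⊩ A ∨ B  = ∀ x {Δ} → Γ ⊆ Δ →
               (∀ {Δ'} → Δ ⊆ Δ' → Δ' ⊩ A → Der S Δ' (atom x)) →
               (∀ {Δ'} → Δ ⊆ Δ' → Δ' ⊩ B → Der S Δ' (atom x)) →
               Der S Δ (atom x)

  ⊩-mono : ∀ A {Γ Δ} → Γ ⊆ Δ → Γ ⊩ A → Δ ⊩ A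
  ⊩-mono (atom p) s d           = Der-weaken s d
  ⊩-mono ⊥'       s d x         = Der-weaken s (d x)
  ⊩-mono (A ⇒ B)  s f t         = f (⊆-trans s t)
  ⊩-mono (A ∧ B)  s (a , b)     = ⊩-mono A s a , ⊩-mono B s b
  ⊩-mono (A ∨ B)  s k x t       = k x (⊆-trans s t)

  ⊩-⊥E : ∀ C {Γ} → Γ ⊩ ⊥' → Γ ⊩ C
  ⊩-⊥E (atom p) h           = h p
  ⊩-⊥E ⊥'       h           = h
  ⊩-⊥E (A ⇒ B)  h s _       = ⊩-⊥E B (⊩-mono ⊥' s h)
  ⊩-⊥E (A ∧ B)  h           = ⊩-⊥E A h , ⊩-⊥E B h
  ⊩-⊥E (A ∨ B)  h x s _ _   = Der-weaken s (h x)

  ⊩-∨E : ∀ C A B {Γ} → Γ ⊩ A ∨ B →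
         (∀ {Δ} → Γ ⊆ Δ → Δ ⊩ A → Δ ⊩ C) →
         (∀ {Δ} → Γ ⊆ Δ → Δ ⊩ B → Δ ⊩ C) → Γ ⊩ C
  ⊩-∨E (atom p) A B k f g = k p ⊆-refl f g
  ⊩-∨E ⊥'       A B k f g x = k x ⊆-refl (λ s a → f s a x) (λ s b → g s b x)
  ⊩-∨E (C ⇒ D)  A B k f g s c =
    ⊩-∨E D A B (⊩-mono (A ∨ B) s k)
      (λ t a → f (⊆-trans s t) a ⊆-refl (⊩-mono C t c))
      (λ t b → g (⊆-trans s t) b ⊆-refl (⊩-mono C t c))
  ⊩-∨E (C ∧ D)  A B k f g =
    ⊩-∨E C A B k (λ s → proj₁ ∘ f s) (λ s → proj₁ ∘ g s) ,
    ⊩-∨E D A B k (λ s → proj₂ ∘ f s) (λ s → proj₂ ∘ g s)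
  ⊩-∨E (C ∨ D)  A B k f g x s l r =
    k x s (λ t a → f (⊆-trans s t) a x ⊆-refl (l ∘ ⊆-trans t) (r ∘ ⊆-trans t))
          (λ t b → g (⊆-trans s t) b x ⊆-refl (l ∘ ⊆-trans t) (r ∘ ⊆-trans t))

  _⊩*_ : List Form → List Form → Set
  Δ ⊩* Γ = ∀ {B} → B ∈ Γ → Δ ⊩ B

  ⊩*-mono : ∀ {Γ Δ Δ'} → Δ ⊆ Δ' → Δ ⊩* Γ → Δ' ⊩* Γ
  ⊩*-mono s ρ {B} x = ⊩-mono B s (ρ x)

  ⊩*-∷ : ∀ {Γ Δ A} → Δ ⊩ A → Δ ⊩* Γ → Δ ⊩* A ∷ Γ
  ⊩*-∷ a ρ (here refl) = a
  ⊩*-∷ a ρ (there x)   = ρ x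

  ⊩-sound : ∀ {Γ A Δ} → Der (λ _ → ⊥) Γ A → Δ ⊩* Γ → Δ ⊩ A
  ⊩-sound (hypS ())
  ⊩-sound (hypΓ x)   ρ = ρ x
  ⊩-sound (⇒I d)     ρ s a = ⊩-sound d (⊩*-∷ a (⊩*-mono s ρ))
  ⊩-sound (⇒E d e)   ρ = ⊩-sound d ρ ⊆-refl (⊩-sound e ρ)
  ⊩-sound (∧I d e)   ρ = ⊩-sound d ρ , ⊩-sound e ρ
  ⊩-sound (∧E₁ d)    ρ = proj₁ (⊩-sound d ρ)
  ⊩-sound (∧E₂ d)    ρ = proj₂ (⊩-sound d ρ)
  ⊩-sound (∨I₁ {A = A} d) ρ x s l r = l ⊆-refl (⊩-mono A s (⊩-sound d ρ))
  ⊩-sound (∨I₂ {B = B} d) ρ x s l r = r ⊆-refl (⊩-mono B s (⊩-sound d ρ))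
  ⊩-sound (∨E {A = A} {B} {C} d e f) ρ =
    ⊩-∨E C A B (⊩-sound d ρ)
      (λ s a → ⊩-sound e (⊩*-∷ a (⊩*-mono s ρ)))
      (λ s b → ⊩-sound f (⊩*-∷ b (⊩*-mono s ρ)))
  ⊩-sound (⊥E {A = A} d) ρ = ⊩-⊥E A (⊩-sound d ρ)

module Simulation (φ : Form) (♭ : Form → ℕ)
                  (♭-atom : ∀ p → Sub (atom p) φ → ♭ (atom p) ≡ p) where

  open Forcing (N φ ♭)

  axiom : ∀ {χ ψ Γ} → Sub χ φ → M ♭ χ ψ → Der (N φ ♭) Γ ψ
  axiom s m = hypS (inj₁ (_ , s , m))

  fl-atom : ∀ {p} → Sub (atom p) φ → fl ♭ (atom p) ≡ atom p
  fl-atom {p} s = cong atom (♭-atom p s)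

  reify   : ∀ χ {Γ} → Sub χ φ → Γ ⊩ χ → Der (N φ ♭) Γ (fl ♭ χ)
  reflect : ∀ χ {Γ} → Sub χ φ → Der (N φ ♭) Γ (fl ♭ χ) → Γ ⊩ χ

  reify (atom p) s d = subst (Der _ _) (sym (fl-atom s)) d
  reify ⊥'       s h = h (♭ ⊥')
  reify (a ⇒ b)  s f =
    ⇒E (axiom s ⇒-2) (⇒I (reify b (Sub-trans (⇒r here) s)
      (f (xs⊆x∷xs _ _) (reflect a (Sub-trans (⇒l here) s) (hypΓ (here refl))))))
  reify (a ∧ b)  s (p , q) =
    ⇒E (axiom s ∧-3)
      (∧I (reify a (Sub-trans (∧l here) s) p) (reify b (Sub-trans (∧r here) s) q))
  reify (a ∨ b)  s k =
    k (♭ (a ∨ b)) ⊆-refl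
      (λ _ x → ⇒E (axiom s ∨-1) (reify a (Sub-trans (∨l here) s) x))
      (λ _ x → ⇒E (axiom s ∨-2) (reify b (Sub-trans (∨r here) s) x))

  reflect (atom p) s d = subst (Der _ _) (fl-atom s) d
  reflect ⊥'       s d x = ⇒E (hypS (inj₂ (x , refl))) d
  reflect (a ⇒ b)  s d t x =
    reflect b (Sub-trans (⇒r here) s)
      (⇒E (axiom s ⇒-1) (∧I (Der-weaken t d) (reify a (Sub-trans (⇒l here) s) x)))
  reflect (a ∧ b)  s d =
    reflect a (Sub-trans (∧l here) s) (⇒E (axiom s ∧-1) d) ,
    reflect b (Sub-trans (∧r here) s) (⇒E (axiom s ∧-2) d)
  reflect (a ∨ b)  s d x t l r =
    ⇒E (axiom s (∨-3 x))
      (∧I (∧I (Der-weaken t d)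
              (⇒I (l (xs⊆x∷xs _ _)
                     (reflect a (Sub-trans (∨l here) s) (hypΓ (here refl))))))
          (⇒I (r (xs⊆x∷xs _ _) (reflect b (Sub-trans (∨r here) s) (hypΓ (here refl))))))

  N-complete : Provable φ → N φ ♭ ⊢ fl ♭ φ
  N-complete d = reify φ here (⊩-sound d (λ ()))

subformulas       : Form → List Form
properSubformulas : Form → List Form

subformulas φ = φ ∷ properSubformulas φ

properSubformulas (atom p) = []
properSubformulas ⊥'       = []
properSubformulas (a ⇒ b)  = subformulas a ++ subformulas b
properSubformulas (a ∧ b)  = subformulas a ++ subformulas b
properSubformulas (a ∨ b)  = subformulas a ++ subformulas b

∈-subformulas⁺ : ∀ {χ φ} → Sub χ φ → χ ∈ subformulas φ
∈-subformulas⁺ here           = here refl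
∈-subformulas⁺ (⇒l s)         = there (∈-++⁺ˡ (∈-subformulas⁺ s))
∈-subformulas⁺ (⇒r {a = a} s) = there (∈-++⁺ʳ (subformulas a) (∈-subformulas⁺ s))
∈-subformulas⁺ (∧l s)         = there (∈-++⁺ˡ (∈-subformulas⁺ s))
∈-subformulas⁺ (∧r {a = a} s) = there (∈-++⁺ʳ (subformulas a) (∈-subformulas⁺ s))
∈-subformulas⁺ (∨l s)         = there (∈-++⁺ˡ (∈-subformulas⁺ s))
∈-subformulas⁺ (∨r {a = a} s) = there (∈-++⁺ʳ (subformulas a) (∈-subformulas⁺ s))

∈-subformulas⁻ : ∀ {χ} φ → χ ∈ subformulas φ → Sub χ φ
∈-subformulas⁻ φ       (here refl) = here
∈-subformulas⁻ (a ⇒ b) (there x) =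
  [ ⇒l ∘ ∈-subformulas⁻ a , ⇒r ∘ ∈-subformulas⁻ b ] (∈-++⁻ (subformulas a) x)
∈-subformulas⁻ (a ∧ b) (there x) =
  [ ∧l ∘ ∈-subformulas⁻ a , ∧r ∘ ∈-subformulas⁻ b ] (∈-++⁻ (subformulas a) x)
∈-subformulas⁻ (a ∨ b) (there x) =
  [ ∨l ∘ ∈-subformulas⁻ a , ∨r ∘ ∈-subformulas⁻ b ] (∈-++⁻ (subformulas a) x)

module _ {A : Set} (f : A → ℕ) (xs : List A) (default : A) where

  invert : ℕ → A
  invert n with any? (λ x → f x ≟ n) xs
  ... | yes p = proj₁ (find p)
  ... | no _  = default

  invert-inverse : (∀ {x y} → x ∈ xs → y ∈ xs → f x ≡ f y → x ≡ y) →
                   ∀ {x} → x ∈ xs → invert (f x) ≡ x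
  invert-inverse f-injective {x} x∈xs with any? (λ y → f y ≟ f x) xs
  ... | yes p = let _ , y∈xs , fy≡fx = find p in f-injective y∈xs x∈xs fy≡fx
  ... | no ¬p = contradiction (lose x∈xs refl) ¬p

substitute : (ℕ → Form) → Form → Form
substitute σ (atom n) = σ n
substitute σ ⊥'       = ⊥'
substitute σ (A ⇒ B)  = substitute σ A ⇒ substitute σ B
substitute σ (A ∧ B)  = substitute σ A ∧ substitute σ B
substitute σ (A ∨ B)  = substitute σ A ∨ substitute σ B

Der-substitute : ∀ {S T Γ A} σ → (∀ {B} → S B → T ⊢ substitute σ B) →
                 Der S Γ A → Der T (map (substitute σ) Γ) (substitute σ A)
Der-substitute σ h (hypS x)   = Der-weaken (λ ()) (h x)
Der-substitute σ h (hypΓ x)   = hypΓ (∈-map⁺ (substitute σ) x)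
Der-substitute σ h (⇒I d)     = ⇒I (Der-substitute σ h d)
Der-substitute σ h (⇒E d e)   = ⇒E (Der-substitute σ h d) (Der-substitute σ h e)
Der-substitute σ h (∧I d e)   = ∧I (Der-substitute σ h d) (Der-substitute σ h e)
Der-substitute σ h (∧E₁ d)    = ∧E₁ (Der-substitute σ h d)
Der-substitute σ h (∧E₂ d)    = ∧E₂ (Der-substitute σ h d)
Der-substitute σ h (∨I₁ d)    = ∨I₁ (Der-substitute σ h d)
Der-substitute σ h (∨I₂ d)    = ∨I₂ (Der-substitute σ h d)
Der-substitute σ h (∨E d e f) =
  ∨E (Der-substitute σ h d) (Der-substitute σ h e) (Der-substitute σ h f)
Der-substitute σ h (⊥E d)     = ⊥E (Der-substitute σ h d)

module Unflattening (φ : Form) (♭ : Form → ℕ)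
                    (♭-injective : ∀ χ ψ → InΞ⊥ φ χ → InΞ⊥ φ ψ → ♭ χ ≡ ♭ ψ → χ ≡ ψ) where

  Ξ⊥ : List Form
  Ξ⊥ = ⊥' ∷ subformulas φ

  ∈-Ξ⊥⁺ : ∀ {χ} → InΞ⊥ φ χ → χ ∈ Ξ⊥
  ∈-Ξ⊥⁺ (inj₁ s)    = there (∈-subformulas⁺ s)
  ∈-Ξ⊥⁺ (inj₂ refl) = here refl

  ∈-Ξ⊥⁻ : ∀ {χ} → χ ∈ Ξ⊥ → InΞ⊥ φ χ
  ∈-Ξ⊥⁻ (here refl) = inj₂ refl
  ∈-Ξ⊥⁻ (there x)   = inj₁ (∈-subformulas⁻ φ x)

  unflat : ℕ → Form
  unflat = invert ♭ Ξ⊥ ⊥'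

  unflat-♭ : ∀ {χ} → InΞ⊥ φ χ → unflat (♭ χ) ≡ χ
  unflat-♭ i = invert-inverse ♭ Ξ⊥ ⊥'
    (λ x y → ♭-injective _ _ (∈-Ξ⊥⁻ x) (∈-Ξ⊥⁻ y)) (∈-Ξ⊥⁺ i)

  unflat-sub : ∀ {χ} → Sub χ φ → unflat (♭ χ) ≡ χ
  unflat-sub = unflat-♭ ∘ inj₁

  unflat-N : ∀ {B} → N φ ♭ B → Provable (substitute unflat B)
  unflat-N (inj₂ (x , refl)) rewrite unflat-♭ (inj₂ refl) = ⇒I (⊥E (hypΓ (here refl)))
  unflat-N (inj₁ ((a ∧ b) , s , ∧-1))
    rewrite unflat-sub s | unflat-sub (Sub-trans (∧l here) s) = ⇒I (∧E₁ (hypΓ (here refl)))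
  unflat-N (inj₁ ((a ∧ b) , s , ∧-2))
    rewrite unflat-sub s | unflat-sub (Sub-trans (∧r here) s) = ⇒I (∧E₂ (hypΓ (here refl)))
  unflat-N (inj₁ ((a ∧ b) , s , ∧-3))
    rewrite unflat-sub s
          | unflat-sub (Sub-trans (∧l here) s)
          | unflat-sub (Sub-trans (∧r here) s) =
    ⇒I (hypΓ (here refl))
  unflat-N (inj₁ ((a ∨ b) , s , ∨-1))
    rewrite unflat-sub s | unflat-sub (Sub-trans (∨l here) s) = ⇒I (∨I₁ (hypΓ (here refl)))
  unflat-N (inj₁ ((a ∨ b) , s , ∨-2))
    rewrite unflat-sub s | unflat-sub (Sub-trans (∨r here) s) = ⇒I (∨I₂ (hypΓ (here refl)))
  unflat-N (inj₁ ((a ∨ b) , s , ∨-3 x))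
    rewrite unflat-sub s
          | unflat-sub (Sub-trans (∨l here) s)
          | unflat-sub (Sub-trans (∨r here) s) =
    ⇒I (∨E (∧E₁ (∧E₁ (hypΓ (here refl))))
           (⇒E (∧E₂ (∧E₁ (hypΓ (there (here refl))))) (hypΓ (here refl)))
           (⇒E (∧E₂ (hypΓ (there (here refl)))) (hypΓ (here refl))))
  unflat-N (inj₁ ((a ⇒ b) , s , ⇒-1))
    rewrite unflat-sub s
          | unflat-sub (Sub-trans (⇒l here) s)
          | unflat-sub (Sub-trans (⇒r here) s) =
    ⇒I (⇒E (∧E₁ (hypΓ (here refl))) (∧E₂ (hypΓ (here refl))))
  unflat-N (inj₁ ((a ⇒ b) , s , ⇒-2))
    rewrite unflat-sub s
          | unflat-sub (Sub-trans (⇒l here) s)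
          | unflat-sub (Sub-trans (⇒r here) s) =
    ⇒I (hypΓ (here refl))

  N-sound : N φ ♭ ⊢ fl ♭ φ → Provable φ
  N-sound d = subst Provable (unflat-sub here) (Der-substitute unflat unflat-N d)

lemma4p2 : (φ : Form) (♭ : Form → ℕ) → IsFlat φ ♭ →
           Provable φ ⇔ (N φ ♭ ⊢ fl ♭ φ)
lemma4p2 φ ♭ (♭-injective , ♭-atom) =
  mk⇔ (Simulation.N-complete φ ♭ ♭-atom) (Unflattening.N-sound φ ♭ ♭-injective)
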